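{- For every positive integer $n$, \[ \tilde{F}\!\left(\frac{n}{2^{\lfloor \lg n \rfloor}}\right) \;=\; \frac{n\left(\lfloor \lg n \rfloor + 2\right) - 2B(n)}{2^{\lfloor \lg n \rfloor}} - 2. \]
   Context: $\lg$ is the logarithm to base 2. For a real number $x$, $\mathrm{Zigzag}(x) = \min\left(x - \lfloor x \rfloor,\ \lceil x \rceil - x\right)$. The function $\tilde{F}:\mathbb{R}\to\mathbb{R}$ is $\tilde{F}(x) = \sum_{i=0}^{\infty} 2^{ -i}\, \mathrm{Zigzag}(2^i x)$. $B$ is the function on positive integers defined by $B(1) = 0$ and, for $n \ge 2$, $B(n) = \lfloor n/2 \rfloor + B(\lfloor n/2 \rfloor) + B(\lceil n/2 \rceil)$. -}

module Defs where

open import Data.Nat as ℕ using (ℕ; zero; suc; _≤?_; ⌊_/2⌋; ⌈_/2⌉)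
open import Data.Nat.Logarithm using (⌊log₂_⌋)
import Data.Nat.Properties as ℕP
open import Data.Integer as ℤ using (ℤ; +_)
open import Data.Rational as ℚ using (ℚ; floor; ceiling; _⊓_; _-_; _+_; _*_; _<_; ∣_∣; 0ℚ)
open import Data.Product using (∃-syntax)
open import Relation.Nullary using (yes; no)

ιℤ : ℤ → ℚ
ιℤ z = z ℚ./ 1

Zigzag : ℚ → ℚ
Zigzag x = (x - ιℤ (floor x)) ⊓ (ιℤ (ceiling x) - x)

pow2 : ℕ → ℚ
pow2 zero = ℚ.1ℚ
pow2 (suc i) = (+ 2) ℚ./ 1 * pow2 i

invpow2 : ℕ → ℚ
invpow2 i = (+ 1) ℚ./ (2 ℕ.^ i)
  where instance _ = ℕP.m^n≢0 2 i

term : ℚ → ℕ → ℚ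
term x i = invpow2 i * Zigzag (pow2 i * x)

partial : ℚ → ℕ → ℚ
partial x zero = 0ℚ
partial x (suc m) = partial x m + term x m

ConvergesTo : (ℕ → ℚ) → ℚ → Set
ConvergesTo s v = ∀ (ε : ℚ) → 0ℚ < ε → ∃[ M ] ∀ m → M ℕ.≤ m → ∣ s m - v ∣ < ε

-- F̃(x) = v  :⇔  the series Σ_{i≥0} 2^{-i} Zigzag(2^i x) converges to v
F̃≡ : ℚ → ℚ → Set
F̃≡ x v = ConvergesTo (partial x) v

-- B with fuel; B(1)=0, B(n)=⌊n/2⌋+B(⌊n/2⌋)+B(⌈n/2⌉) for n ≥ 2 (fuel n suffices)
Bfuel : ℕ → ℕ → ℕ
Bfuel zero n = 0
Bfuel (suc f) n with n ≤? 1
... | yes _ = 0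
... | no _ = ⌊ n /2⌋ ℕ.+ Bfuel f ⌊ n /2⌋ ℕ.+ Bfuel f ⌈ n /2⌉

B : ℕ → ℕ
B n = Bfuel n n

_/2^_ : ℤ → ℕ → ℚ
z /2^ k = z ℚ./ (2 ℕ.^ k)
  where instance _ = ℕP.m^n≢0 2 k

-- Write d(m, D) for the distance from m to the nearest multiple of D. For x = n / 2^k the i-th
-- term 2^-i Zigzag(2^i x) of the series is d(n, 2^(k-i)) / 2^k for i ≤ k and vanishes for i ≥ k,
-- so the partial sums are eventually constant with value S(n, k) / 2^k, where
-- S(n, K) = Σ_{j=1..K} d(n, 2^j). Since d(2p, 2D) = 2 d(p, D), and d(2p+1, 2D) = d(p, D) + d(p+1, D)
-- for even D, splitting n into ⌊n/2⌋ + ⌈n/2⌉ as in the recurrence for B gives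
-- S(n, K+1) = (⌈n/2⌉ - ⌊n/2⌋) + S(⌊n/2⌋, K) + S(⌈n/2⌉, K). Induction on K then yields
-- S(n, K) + 2 B(n) + 2^(K+1) = n (K + 2) whenever 2^K ≤ n ≤ 2^(K+1); take K = ⌊lg n⌋.

module Submission where

open import Defs
open import Data.Nat as ℕ using (ℕ; NonZero)
open import Data.Nat.Logarithm using (⌊log₂_⌋)
open import Data.Integer as ℤ using (+_)
open import Data.Rational as ℚ using (ℚ)

open import Data.Nat using (zero; suc; _+_; _*_; _∸_; _⊓_; _^_; _≤_; _<_; z≤n; s≤s; z<s; ⌊_/2⌋; ⌈_/2⌉)
import Data.Nat.Properties as ℕP
import Data.Nat.DivMod as ℕD
open ℕD using (_%_)
open import Data.Nat.Logarithm using (⌊log₂⌋-mono-≤; ⌊log₂⌊n/2⌋⌋≡⌊log₂n⌋∸1)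
open import Data.Nat.Tactic.RingSolver using (solve-∀)
open import Data.Integer using (-[1+_]; +[1+_])
import Data.Integer.Properties as ℤP
import Data.Integer.DivMod as ℤD
import Data.Integer.Tactic.RingSolver as ℤSolver
open import Data.Rational using (mkℚ; _/_)
import Data.Rational.Properties as ℚP
open import Data.Rational.Unnormalised using (mkℚᵘ; *≡*; *≤*) renaming (_≃_ to _≃ᵘ_)
import Data.Rational.Unnormalised as ℚᵘ
import Data.Rational.Unnormalised.Properties as ℚᵘP
open import Data.Product using (∃; ∃₂; _×_; _,_; proj₁; proj₂)
open import Data.Sum using (inj₁; inj₂)
open import Data.Empty using (⊥-elim)
open import Function using (_∘_)
open import Relation.Binary.PropositionalEquality

distToMultiple : (m d : ℕ) .{{_ : NonZero d}} → ℕ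
distToMultiple m d = (m % d) ⊓ (d ∸ m % d)

data EvenOdd : ℕ → Set where
  even : ∀ p → EvenOdd (p + p)
  odd  : ∀ p → EvenOdd (suc (p + p))

evenOdd : ∀ n → EvenOdd n
evenOdd zero = even 0
evenOdd (suc n) with evenOdd n
... | even p = odd p
... | odd p  = subst EvenOdd (cong suc (ℕP.+-suc p p)) (even (suc p))

odd≢even : ∀ m n → suc (m + m) ≢ n + n
odd≢even m n eq = ℕP.1+n≢n (trans 1+m≡n (sym m≡n))
  where
  m≡n : m ≡ n
  m≡n = trans (ℕP.n≡⌈n+n/2⌉ m) (trans (cong ⌊_/2⌋ eq) (sym (ℕP.n≡⌊n+n/2⌋ n)))
  1+m≡n : suc m ≡ n
  1+m≡n = trans (cong suc (ℕP.n≡⌊n+n/2⌋ m)) (trans (cong ⌈_/2⌉ eq) (sym (ℕP.n≡⌈n+n/2⌉ n)))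

⊓-double : ∀ a b → (a + a) ⊓ (b + b) ≡ a ⊓ b + a ⊓ b
⊓-double zero b = refl
⊓-double (suc a) zero = refl
⊓-double (suc a) (suc b) = begin
  suc (a + suc a) ⊓ suc (b + suc b)   ≡⟨ cong₂ (λ x y → suc x ⊓ suc y) (ℕP.+-suc a a) (ℕP.+-suc b b) ⟩
  suc (suc ((a + a) ⊓ (b + b)))       ≡⟨ cong (suc ∘ suc) (⊓-double a b) ⟩
  suc (suc (a ⊓ b + a ⊓ b))           ≡⟨ cong suc (sym (ℕP.+-suc (a ⊓ b) (a ⊓ b))) ⟩
  suc (a ⊓ b) + suc (a ⊓ b)           ∎
  where open ≡-Reasoning

⊓-odd-split : ∀ a b → a ≢ b → suc (a + a) ⊓ suc (b + b) ≡ a ⊓ suc b + suc a ⊓ b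
⊓-odd-split zero zero a≢b = ⊥-elim (a≢b refl)
⊓-odd-split zero (suc b) _ = refl
⊓-odd-split (suc a) zero _ = cong suc (sym (trans (ℕP.+-identityʳ (a ⊓ 0)) (ℕP.⊓-zeroʳ a)))
⊓-odd-split (suc a) (suc b) a≢b = begin
  suc (suc (a + suc a) ⊓ suc (b + suc b))
    ≡⟨ cong₂ (λ x y → suc (suc x ⊓ suc y)) (ℕP.+-suc a a) (ℕP.+-suc b b) ⟩
  suc (suc (suc (a + a) ⊓ suc (b + b)))
    ≡⟨ cong (suc ∘ suc) (⊓-odd-split a b (a≢b ∘ cong suc)) ⟩
  suc (suc (a ⊓ suc b + suc a ⊓ b))
    ≡⟨ cong suc (sym (ℕP.+-suc (a ⊓ suc b) (suc a ⊓ b))) ⟩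
  suc (a ⊓ suc b) + suc (suc a ⊓ b) ∎
  where open ≡-Reasoning

distToMultiple-char : ∀ {m d} r q s .{{_ : NonZero d}} → m ≡ r + q * d → d ≡ r + s →
                      distToMultiple m d ≡ r ⊓ s
distToMultiple-char {m} {d} r q zero m≡ d≡ = begin
  (m % d) ⊓ (d ∸ m % d)   ≡⟨ cong (λ x → x ⊓ (d ∸ x)) m%d≡0 ⟩
  0                       ≡⟨ sym (ℕP.⊓-zeroʳ r) ⟩
  r ⊓ 0                   ∎
  where
  open ≡-Reasoning
  m%d≡0 : m % d ≡ 0
  m%d≡0 = trans (ℕD.%-congˡ (trans m≡ (cong (_+ q * d) r≡d))) (ℕD.m*n%n≡0 (suc q) d)
    where
    r≡d : r ≡ d
    r≡d = trans (sym (ℕP.+-identityʳ r)) (sym d≡)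
distToMultiple-char {m} {d} r q (suc s) m≡ d≡ = begin
  (m % d) ⊓ (d ∸ m % d)   ≡⟨ cong (λ x → x ⊓ (d ∸ x)) m%d≡r ⟩
  r ⊓ (d ∸ r)             ≡⟨ cong (λ y → r ⊓ (y ∸ r)) d≡ ⟩
  r ⊓ (r + suc s ∸ r)     ≡⟨ cong (r ⊓_) (ℕP.m+n∸m≡n r (suc s)) ⟩
  r ⊓ suc s               ∎
  where
  open ≡-Reasoning
  m%d≡r : m % d ≡ r
  m%d≡r = trans (ℕD.%-congˡ m≡) (trans (ℕD.[m+kn]%n≡m%n r q d)
            (ℕD.m<n⇒m%n≡m (subst (r <_) (sym d≡) (ℕP.m<m+n r z<s))))

divMod-decomposition : ∀ m d .{{_ : NonZero d}} →
                       ∃₂ λ r q → ∃ λ s → m ≡ r + q * d × d ≡ r + suc s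
divMod-decomposition m d = m % d , m ℕD./ d , d ∸ suc (m % d) , ℕD.m≡m%n+[m/n]*n m d , d≡
  where
  d≡ : d ≡ m % d + suc (d ∸ suc (m % d))
  d≡ = trans (sym (ℕP.m+[n∸m]≡n (ℕD.m%n<n m d))) (sym (ℕP.+-suc (m % d) (d ∸ suc (m % d))))

distToMultiple-double : ∀ m {D d} .{{_ : NonZero D}} .{{_ : NonZero d}} → D ≡ d + d →
                        distToMultiple (m + m) D ≡ distToMultiple m d + distToMultiple m d
distToMultiple-double m {d = d} refl with divMod-decomposition m d
... | r , q , s , m≡ , d≡ = begin
  distToMultiple (m + m) (d + d)    ≡⟨ distToMultiple-char (r + r) q (suc s + suc s) m+m≡ d+d≡ ⟩
  (r + r) ⊓ (suc s + suc s)        ≡⟨ ⊓-double r (suc s) ⟩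
  r ⊓ suc s + r ⊓ suc s            ≡⟨ sym (cong₂ _+_ dist-m dist-m) ⟩
  distToMultiple m d + distToMultiple m d ∎
  where
  open ≡-Reasoning
  m+m≡ : m + m ≡ (r + r) + q * (d + d)
  m+m≡ = trans (cong₂ _+_ m≡ m≡) (rearrange r q d)
    where
    rearrange : ∀ r q d → (r + q * d) + (r + q * d) ≡ (r + r) + q * (d + d)
    rearrange = solve-∀
  d+d≡ : d + d ≡ (r + r) + (suc s + suc s)
  d+d≡ = trans (cong₂ _+_ d≡ d≡) (rearrange r (suc s))
    where
    rearrange : ∀ a b → (a + b) + (a + b) ≡ (a + a) + (b + b)
    rearrange = solve-∀
  dist-m : distToMultiple m d ≡ r ⊓ suc s
  dist-m = distToMultiple-char r q (suc s) m≡ d≡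

distToMultiple-odd : ∀ m {D d} t .{{_ : NonZero D}} .{{_ : NonZero d}} → D ≡ d + d → d ≡ t + t →
                     distToMultiple (suc (m + m)) D ≡ distToMultiple m d + distToMultiple (suc m) d
distToMultiple-odd m {d = d} t refl d≡t+t with divMod-decomposition m d
... | r , q , s , m≡ , d≡ = begin
  distToMultiple (suc (m + m)) (d + d)   ≡⟨ distToMultiple-char (suc (r + r)) q (suc (s + s)) 1+m+m≡ d+d≡ ⟩
  suc (r + r) ⊓ suc (s + s)              ≡⟨ ⊓-odd-split r s r≢s ⟩
  r ⊓ suc s + suc r ⊓ s                  ≡⟨ sym (cong₂ _+_ (distToMultiple-char r q (suc s) m≡ d≡)
                                                          (distToMultiple-char (suc r) q s (cong suc m≡) d≡′)) ⟩
  distToMultiple m d + distToMultiple (suc m) d ∎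
  where
  open ≡-Reasoning
  1+m+m≡ : suc (m + m) ≡ suc (r + r) + q * (d + d)
  1+m+m≡ = trans (cong₂ (λ x y → suc (x + y)) m≡ m≡) (rearrange r q d)
    where
    rearrange : ∀ r q d → suc ((r + q * d) + (r + q * d)) ≡ suc (r + r) + q * (d + d)
    rearrange = solve-∀
  d+d≡ : d + d ≡ suc (r + r) + suc (s + s)
  d+d≡ = trans (cong₂ _+_ d≡ d≡) (rearrange r s)
    where
    rearrange : ∀ r s → (r + suc s) + (r + suc s) ≡ suc (r + r) + suc (s + s)
    rearrange = solve-∀
  d≡′ : d ≡ suc r + s
  d≡′ = trans d≡ (ℕP.+-suc r s)
  r≢s : r ≢ s
  r≢s refl = odd≢even r t (trans (sym (ℕP.+-suc r r)) (trans (sym d≡) d≡t+t))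

distToMultiple-1 : ∀ m → distToMultiple m 1 ≡ 0
distToMultiple-1 m = distToMultiple-char 0 m 1 (sym (ℕP.*-identityʳ m)) refl

distToMultiple-2 : ∀ n → distToMultiple n 2 ≡ ⌈ n /2⌉ ∸ ⌊ n /2⌋
distToMultiple-2 n with evenOdd n
... | even p = begin
  distToMultiple (p + p) 2                    ≡⟨ distToMultiple-double p refl ⟩
  distToMultiple p 1 + distToMultiple p 1     ≡⟨ cong₂ _+_ (distToMultiple-1 p) (distToMultiple-1 p) ⟩
  0                                           ≡⟨ sym (ℕP.n∸n≡0 p) ⟩
  p ∸ p                                       ≡⟨ cong₂ _∸_ (ℕP.n≡⌈n+n/2⌉ p) (ℕP.n≡⌊n+n/2⌋ p) ⟩
  ⌈ p + p /2⌉ ∸ ⌊ p + p /2⌋                   ∎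
  where open ≡-Reasoning
... | odd p = begin
  distToMultiple (suc (p + p)) 2              ≡⟨ distToMultiple-char 1 p 1 (rearrange p) refl ⟩
  1                                           ≡⟨ sym (ℕP.m+n∸n≡m 1 p) ⟩
  suc p ∸ p                                   ≡⟨ cong₂ _∸_ (cong suc (ℕP.n≡⌊n+n/2⌋ p)) (ℕP.n≡⌈n+n/2⌉ p) ⟩
  ⌈ suc (p + p) /2⌉ ∸ ⌊ suc (p + p) /2⌋       ∎
  where
  open ≡-Reasoning
  rearrange : ∀ p → suc (p + p) ≡ 1 + p * 2
  rearrange = solve-∀

distToMultiple-halves : ∀ n {D d} t .{{_ : NonZero D}} .{{_ : NonZero d}} → D ≡ d + d → d ≡ t + t →
                        distToMultiple n D ≡ distToMultiple ⌊ n /2⌋ d + distToMultiple ⌈ n /2⌉ d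
distToMultiple-halves n {d = d} t D≡ d≡ with evenOdd n
... | even p = begin
  distToMultiple (p + p) _
    ≡⟨ distToMultiple-double p D≡ ⟩
  distToMultiple p d + distToMultiple p d
    ≡⟨ cong₂ (λ a b → distToMultiple a d + distToMultiple b d) (ℕP.n≡⌊n+n/2⌋ p) (ℕP.n≡⌈n+n/2⌉ p) ⟩
  distToMultiple ⌊ p + p /2⌋ d + distToMultiple ⌈ p + p /2⌉ d ∎
  where open ≡-Reasoning
... | odd p = begin
  distToMultiple (suc (p + p)) _
    ≡⟨ distToMultiple-odd p t D≡ d≡ ⟩
  distToMultiple p d + distToMultiple (suc p) d
    ≡⟨ cong₂ (λ a b → distToMultiple a d + distToMultiple (suc b) d) (ℕP.n≡⌈n+n/2⌉ p) (ℕP.n≡⌊n+n/2⌋ p) ⟩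
  distToMultiple ⌊ suc (p + p) /2⌋ d + distToMultiple ⌈ suc (p + p) /2⌉ d ∎
  where open ≡-Reasoning

2^≢0 : ∀ k → NonZero (2 ^ k)
2^≢0 k = ℕP.m^n≢0 2 k

distTo2^ : ℕ → ℕ → ℕ
distTo2^ m j = distToMultiple m (2 ^ j) {{2^≢0 j}}

dyadicDistSum : ℕ → ℕ → ℕ
dyadicDistSum n zero    = 0
dyadicDistSum n (suc K) = distTo2^ n (suc K) + dyadicDistSum n K

2*n≡n+n : ∀ n → 2 * n ≡ n + n
2*n≡n+n n = cong (_+_ n) (ℕP.+-identityʳ n)

dyadicDistSum-halves : ∀ n K → dyadicDistSum n (suc K) ≡
  (⌈ n /2⌉ ∸ ⌊ n /2⌋) + dyadicDistSum ⌊ n /2⌋ K + dyadicDistSum ⌈ n /2⌉ K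
dyadicDistSum-halves n zero = begin
  distToMultiple n 2 + 0      ≡⟨ ℕP.+-identityʳ _ ⟩
  distToMultiple n 2          ≡⟨ distToMultiple-2 n ⟩
  ⌈ n /2⌉ ∸ ⌊ n /2⌋           ≡⟨ sym (trans (ℕP.+-identityʳ _) (ℕP.+-identityʳ _)) ⟩
  (⌈ n /2⌉ ∸ ⌊ n /2⌋) + 0 + 0 ∎
  where open ≡-Reasoning
dyadicDistSum-halves n (suc K) = begin
  distTo2^ n (2 + K) + dyadicDistSum n (suc K)
    ≡⟨ cong₂ _+_ halves (dyadicDistSum-halves n K) ⟩
  (distTo2^ a (suc K) + distTo2^ b (suc K)) + ((b ∸ a) + S a K + S b K)
    ≡⟨ rearrange (distTo2^ a (suc K)) (distTo2^ b (suc K)) (b ∸ a) (S a K) (S b K) ⟩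
  (b ∸ a) + S a (suc K) + S b (suc K) ∎
  where
  open ≡-Reasoning
  a = ⌊ n /2⌋
  b = ⌈ n /2⌉
  S : ℕ → ℕ → ℕ
  S = dyadicDistSum
  halves : distTo2^ n (2 + K) ≡ distTo2^ a (suc K) + distTo2^ b (suc K)
  halves = distToMultiple-halves n (2 ^ K) {{2^≢0 (2 + K)}} {{2^≢0 (suc K)}}
             (2*n≡n+n (2 ^ suc K)) (2*n≡n+n (2 ^ K))
  rearrange : ∀ x y z u v → (x + y) + (z + u + v) ≡ z + (x + u) + (y + v)
  rearrange = solve-∀

Bfuel-irrelevant : ∀ f g n → n ≤ f → n ≤ g → Bfuel f n ≡ Bfuel g n
Bfuel-irrelevant zero    zero    zero          _         _         = refl
Bfuel-irrelevant zero    (suc g) zero          _         _         = refl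
Bfuel-irrelevant (suc f) zero    zero          _         _         = refl
Bfuel-irrelevant (suc f) (suc g) zero          _         _         = refl
Bfuel-irrelevant (suc f) (suc g) (suc zero)    _         _         = refl
Bfuel-irrelevant (suc f) (suc g) (suc (suc n)) (s≤s n<f) (s≤s n<g) =
  cong₂ (λ x y → ⌊ 2 + n /2⌋ + x + y)
    (Bfuel-irrelevant f g ⌊ 2 + n /2⌋ (ℕP.≤-trans ⌊⌋≤ n<f) (ℕP.≤-trans ⌊⌋≤ n<g))
    (Bfuel-irrelevant f g ⌈ 2 + n /2⌉ (ℕP.≤-trans ⌈⌉≤ n<f) (ℕP.≤-trans ⌈⌉≤ n<g))
  where
  ⌊⌋≤ : ⌊ 2 + n /2⌋ ≤ suc n
  ⌊⌋≤ = ℕP.≤-pred (ℕP.⌊n/2⌋<n (suc n))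
  ⌈⌉≤ : ⌈ 2 + n /2⌉ ≤ suc n
  ⌈⌉≤ = ℕP.≤-pred (ℕP.⌈n/2⌉<n n)

B-unfold : ∀ n → B (2 + n) ≡ ⌊ 2 + n /2⌋ + B ⌊ 2 + n /2⌋ + B ⌈ 2 + n /2⌉
B-unfold n = cong₂ (λ x y → ⌊ 2 + n /2⌋ + x + y)
  (Bfuel-irrelevant (suc n) _ _ (ℕP.≤-pred (ℕP.⌊n/2⌋<n (suc n))) ℕP.≤-refl)
  (Bfuel-irrelevant (suc n) _ _ (ℕP.≤-pred (ℕP.⌈n/2⌉<n n)) ℕP.≤-refl)

1<2^[1+n] : ∀ n → 1 < 2 ^ suc n
1<2^[1+n] n = ℕP.*-monoʳ-≤ 2 (ℕP.m^n>0 2 n)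

⌊2*n/2⌋≡n : ∀ n → ⌊ 2 * n /2⌋ ≡ n
⌊2*n/2⌋≡n n = trans (cong ⌊_/2⌋ (2*n≡n+n n)) (sym (ℕP.n≡⌊n+n/2⌋ n))

⌈2*n/2⌉≡n : ∀ n → ⌈ 2 * n /2⌉ ≡ n
⌈2*n/2⌉≡n n = trans (cong ⌈_/2⌉ (2*n≡n+n n)) (sym (ℕP.n≡⌈n+n/2⌉ n))

dyadicDistSum+2*B : ∀ K n → 2 ^ K ≤ n → n ≤ 2 ^ suc K →
                    dyadicDistSum n K + 2 * B n + 2 ^ suc K ≡ n * (K + 2)
dyadicDistSum+2*B zero (suc zero)          _ _                 = refl
dyadicDistSum+2*B zero (suc (suc zero))    _ _                 = refl
dyadicDistSum+2*B zero (suc (suc (suc n))) _ (s≤s (s≤s ()))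
dyadicDistSum+2*B (suc K) zero          lo _ = ⊥-elim (ℕP.<⇒≱ (1<2^[1+n] K) (ℕP.≤-trans lo z≤n))
dyadicDistSum+2*B (suc K) (suc zero)    lo _ = ⊥-elim (ℕP.<⇒≱ (1<2^[1+n] K) lo)
dyadicDistSum+2*B (suc K) n@(suc (suc m)) lo hi = begin
  dyadicDistSum n (suc K) + 2 * B n + 2 * P
    ≡⟨ cong₂ (λ x y → x + 2 * y + 2 * P) (dyadicDistSum-halves n K) (B-unfold m) ⟩
  ((b ∸ a) + S a + S b) + 2 * (a + B a + B b) + 2 * P
    ≡⟨ regroup (b ∸ a) a (S a) (S b) (B a) (B b) P ⟩
  ((b ∸ a) + a) + a + (S a + 2 * B a + P) + (S b + 2 * B b + P)
    ≡⟨ cong₂ (λ x y → x + a + y + (S b + 2 * B b + P))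
             (ℕP.m∸n+n≡m (ℕP.⌊n/2⌋≤⌈n/2⌉ n)) (dyadicDistSum+2*B K a 2^K≤a a≤2^K+1) ⟩
  b + a + a * (K + 2) + (S b + 2 * B b + P)
    ≡⟨ cong (λ y → b + a + a * (K + 2) + y) (dyadicDistSum+2*B K b 2^K≤b b≤2^K+1) ⟩
  b + a + a * (K + 2) + b * (K + 2)
    ≡⟨ collect a b K ⟩
  (a + b) * (suc K + 2)
    ≡⟨ cong (_* (suc K + 2)) (ℕP.⌊n/2⌋+⌈n/2⌉≡n n) ⟩
  n * (suc K + 2) ∎
  where
  open ≡-Reasoning
  P = 2 ^ suc K
  a = ⌊ n /2⌋
  b = ⌈ n /2⌉
  S : ℕ → ℕ
  S x = dyadicDistSum x K
  regroup : ∀ c a Sa Sb Ba Bb P → (c + Sa + Sb) + 2 * (a + Ba + Bb) + 2 * P ≡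
            (c + a) + a + (Sa + 2 * Ba + P) + (Sb + 2 * Bb + P)
  regroup = solve-∀
  collect : ∀ a b K → b + a + a * (K + 2) + b * (K + 2) ≡ (a + b) * (suc K + 2)
  collect = solve-∀
  2^K≤a : 2 ^ K ≤ a
  2^K≤a = subst (_≤ a) (⌊2*n/2⌋≡n (2 ^ K)) (ℕP.⌊n/2⌋-mono lo)
  b≤2^K+1 : b ≤ P
  b≤2^K+1 = subst (b ≤_) (⌈2*n/2⌉≡n P) (ℕP.⌈n/2⌉-mono hi)
  2^K≤b : 2 ^ K ≤ b
  2^K≤b = ℕP.≤-trans 2^K≤a (ℕP.⌊n/2⌋≤⌈n/2⌉ n)
  a≤2^K+1 : a ≤ P
  a≤2^K+1 = ℕP.≤-trans (ℕP.⌊n/2⌋≤⌈n/2⌉ n) b≤2^K+1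

⌊log₂⌋-bounds : ∀ k n .{{_ : NonZero n}} → ⌊log₂ n ⌋ ≡ k → 2 ^ k ≤ n × n < 2 ^ suc k
⌊log₂⌋-bounds zero    1             _   = ℕP.≤-refl , s≤s (s≤s z≤n)
⌊log₂⌋-bounds zero    n@(suc (suc m)) eq = ⊥-elim (ℕP.<⇒≱ (s≤s z≤n) 1≤0)
  where
  1≤0 : 1 ≤ 0
  1≤0 = subst (1 ≤_) eq (⌊log₂⌋-mono-≤ {2} {n} (s≤s (s≤s z≤n)))
⌊log₂⌋-bounds (suc k) 1             ()
⌊log₂⌋-bounds (suc k) n@(suc (suc m)) eq
  with ⌊log₂⌋-bounds k ⌊ n /2⌋ (trans (⌊log₂⌊n/2⌋⌋≡⌊log₂n⌋∸1 n) (cong (_∸ 1) eq))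
... | 2^k≤a , a<2^[1+k] = lower , upper
  where
  open ℕP.≤-Reasoning
  a = ⌊ n /2⌋
  b = ⌈ n /2⌉
  lower : 2 ^ suc k ≤ n
  lower = begin
    2 * 2 ^ k   ≤⟨ ℕP.*-monoʳ-≤ 2 2^k≤a ⟩
    2 * a       ≡⟨ 2*n≡n+n a ⟩
    a + a       ≤⟨ ℕP.+-monoʳ-≤ a (ℕP.⌊n/2⌋≤⌈n/2⌉ n) ⟩
    a + b       ≡⟨ ℕP.⌊n/2⌋+⌈n/2⌉≡n n ⟩
    n           ∎
  upper : n < 2 ^ suc (suc k)
  upper = begin-strict
    n                 ≡⟨ sym (ℕP.⌊n/2⌋+⌈n/2⌉≡n n) ⟩
    a + b             <⟨ ℕP.+-monoʳ-≤ (suc a) (ℕP.⌊n/2⌋-mono (ℕP.n≤1+n (suc n))) ⟩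
    suc a + suc a     ≤⟨ ℕP.+-mono-≤ a<2^[1+k] a<2^[1+k] ⟩
    P + P             ≡⟨ sym (2*n≡n+n P) ⟩
    2 * P             ∎
    where P = 2 ^ suc k

toℚᵘ-/ : ∀ i n .{{_ : NonZero n}} → ℚ.toℚᵘ (i / n) ≃ᵘ mkℚᵘ i (ℕ.pred n)
toℚᵘ-/ i (suc n) = ℚP./-injective-≃ _ _ (↥/↧ (i / suc n))
  where
  ↥/↧ : ∀ p → ℚᵘ.↥ (ℚ.toℚᵘ p) / ℚᵘ.↧ₙ (ℚ.toℚᵘ p) ≡ p
  ↥/↧ p@(mkℚ _ _ _) = ℚP.↥p/↧p≡p p

/-cross : ∀ i j m n .{{_ : NonZero m}} .{{_ : NonZero n}} → i ℤ.* + n ≡ j ℤ.* + m → i / m ≡ j / n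
/-cross i j (suc m) (suc n) eq =
  ℚP.toℚᵘ-injective (ℚᵘP.≃-trans (toℚᵘ-/ i _) (ℚᵘP.≃-trans (*≡* eq) (ℚᵘP.≃-sym (toℚᵘ-/ j _))))

/-+-/ : ∀ i j m n .{{_ : NonZero m}} .{{_ : NonZero n}} →
        i / m ℚ.+ j / n ≡ _/_ (i ℤ.* + n ℤ.+ j ℤ.* + m) (m * n) {{ℕP.m*n≢0 m n}}
/-+-/ i j (suc m) (suc n) = ℚP.toℚᵘ-injective (ℚᵘP.≃-trans (ℚP.toℚᵘ-homo-+ (i / suc m) (j / suc n))
  (ℚᵘP.≃-trans (ℚᵘP.+-cong (toℚᵘ-/ i _) (toℚᵘ-/ j _)) (ℚᵘP.≃-sym (toℚᵘ-/ _ (suc m * suc n)))))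

/-*-/ : ∀ i j m n .{{_ : NonZero m}} .{{_ : NonZero n}} →
        (i / m) ℚ.* (j / n) ≡ _/_ (i ℤ.* j) (m * n) {{ℕP.m*n≢0 m n}}
/-*-/ i j (suc m) (suc n) = ℚP.toℚᵘ-injective (ℚᵘP.≃-trans (ℚP.toℚᵘ-homo-* (i / suc m) (j / suc n))
  (ℚᵘP.≃-trans (ℚᵘP.*-cong (toℚᵘ-/ i _) (toℚᵘ-/ j _)) (ℚᵘP.≃-sym (toℚᵘ-/ _ (suc m * suc n)))))

neg-/ : ∀ i n .{{_ : NonZero n}} → ℚ.- (i / n) ≡ (ℤ.- i) / n
neg-/ i (suc n) = ℚP.toℚᵘ-injective (ℚᵘP.≃-trans (ℚP.toℚᵘ-homo‿- (i / suc n))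
  (ℚᵘP.≃-trans (ℚᵘP.-‿cong (toℚᵘ-/ i _)) (ℚᵘP.≃-sym (toℚᵘ-/ _ (suc n)))))

/-sub-/ : ∀ i j m n .{{_ : NonZero m}} .{{_ : NonZero n}} →
        i / m ℚ.- j / n ≡ _/_ (i ℤ.* + n ℤ.+ (ℤ.- j) ℤ.* + m) (m * n) {{ℕP.m*n≢0 m n}}
/-sub-/ i j m n = trans (cong (i / m ℚ.+_) (neg-/ j n)) (/-+-/ i (ℤ.- j) m n)

/-monoˡ-≤ : ∀ {i j} n .{{_ : NonZero n}} → i ℤ.≤ j → i / n ℚ.≤ j / n
/-monoˡ-≤ {i} {j} (suc n) i≤j = ℚP.toℚᵘ-cancel-≤
  (ℚᵘP.≤-respˡ-≃ (ℚᵘP.≃-sym (toℚᵘ-/ i _)) (ℚᵘP.≤-respʳ-≃ (ℚᵘP.≃-sym (toℚᵘ-/ j _))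
    (*≤* (ℤP.*-monoʳ-≤-nonNeg (+ suc n) i≤j))))

/-⊓-/ : ∀ a b n .{{_ : NonZero n}} → (+ a / n) ℚ.⊓ (+ b / n) ≡ + (a ⊓ b) / n
/-⊓-/ a b n with ℕP.≤-total a b
... | inj₁ a≤b = trans (ℚP.p≤q⇒p⊓q≡p (/-monoˡ-≤ n (ℤ.+≤+ a≤b)))
                       (cong (λ c → + c / n) (sym (ℕP.m≤n⇒m⊓n≡m a≤b)))
... | inj₂ b≤a = trans (ℚP.p≥q⇒p⊓q≡q (/-monoˡ-≤ n (ℤ.+≤+ b≤a)))
                       (cong (λ c → + c / n) (sym (ℕP.m≥n⇒m⊓n≡n b≤a)))

/ℕ-unique : ∀ {i q} d .{{_ : NonZero d}} →
            q ℤ.* + d ℤ.≤ i → i ℤ.< ℤ.suc q ℤ.* + d → i ℤD./ℕ d ≡ q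
/ℕ-unique {i} {q} d lower upper = ℤP.≤-antisym
  (squeeze (ℤD.[n/ℕd]*d≤n i d) upper)
  (squeeze lower (ℤD.n<s[n/ℕd]*d i d))
  where
  squeeze : ∀ {a b} → a ℤ.* + d ℤ.≤ i → i ℤ.< ℤ.suc b ℤ.* + d → a ℤ.≤ b
  squeeze {a} {b} a*d≤i i<[1+b]*d = subst (a ℤ.≤_) (ℤP.pred-suc b)
    (ℤP.i<j⇒i≤pred[j] {j = ℤ.suc b} (ℤP.*-cancelʳ-<-nonNeg (+ d) (ℤP.≤-<-trans a*d≤i i<[1+b]*d)))

floor-/ : ∀ i n .{{_ : NonZero n}} → ℚ.floor (i / n) ≡ i ℤD./ℕ n
floor-/ i n = reduced (i / n) (ℚP.↥-/ i n) (ℚP.↧-/ i n)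
  where
  -- i / n is stored in lowest terms; scaling the division bounds of the reduced fraction by the gcd g > 0
  -- gives those of i and n.
  reduced : ∀ p {i n g} .{{_ : NonZero n}} → ℚ.↥ p ℤ.* g ≡ i → ℚ.↧ p ℤ.* g ≡ + n →
            ℚ.floor p ≡ i ℤD./ℕ n
  reduced (mkℚ u d _) {n = suc n} {+ 0} _ ↧*g≡n with trans (sym ↧*g≡n) (ℤP.*-zeroʳ (+ suc d))
  ... | ()
  reduced (mkℚ u d _) {g = -[1+ g ]} _ ()
  reduced (mkℚ u d _) {g = g@(+[1+ _ ])} refl refl =
    trans (ℤD.div-pos-is-/ℕ u (suc d)) (sym (/ℕ-unique _ lower upper))
    where
    q = u ℤD./ℕ suc d
    lower : q ℤ.* (+ suc d ℤ.* g) ℤ.≤ u ℤ.* g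
    lower = subst (ℤ._≤ u ℤ.* g) (ℤP.*-assoc q (+ suc d) g)
              (ℤP.*-monoʳ-≤-nonNeg g (ℤD.[n/ℕd]*d≤n u (suc d)))
    upper : u ℤ.* g ℤ.< ℤ.suc q ℤ.* (+ suc d ℤ.* g)
    upper = subst (u ℤ.* g ℤ.<_) (ℤP.*-assoc (ℤ.suc q) (+ suc d) g)
              (ℤP.*-monoʳ-<-pos g (ℤD.n<s[n/ℕd]*d u (suc d)))

/-sub-floor : ∀ i n .{{_ : NonZero n}} → i / n ℚ.- ιℤ (ℚ.floor (i / n)) ≡ + (i ℤ.%ℕ n) / n
/-sub-floor i n = begin
  i / n ℚ.- ιℤ (ℚ.floor (i / n))   ≡⟨ cong (λ z → i / n ℚ.- ιℤ z) (floor-/ i n) ⟩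
  i / n ℚ.- q / 1                  ≡⟨ /-sub-/ i q n 1 ⟩
  _/_ j (n * 1) {{ℕP.m*n≢0 n 1}}   ≡⟨ /-cross j (+ r) (n * 1) n {{ℕP.m*n≢0 n 1}} j*n≡r*n ⟩
  + r / n                          ∎
  where
  open ≡-Reasoning
  q = i ℤD./ℕ n
  r = i ℤ.%ℕ n
  j = i ℤ.* + 1 ℤ.+ (ℤ.- q) ℤ.* + n
  cancel : ∀ r q n → ((r ℤ.+ q ℤ.* n) ℤ.* + 1 ℤ.+ (ℤ.- q) ℤ.* n) ℤ.* n ≡ r ℤ.* (n ℤ.* + 1)
  cancel = ℤSolver.solve-∀
  j*n≡r*n : j ℤ.* + n ≡ + r ℤ.* + (n * 1)
  j*n≡r*n = begin
    (i ℤ.* + 1 ℤ.+ (ℤ.- q) ℤ.* + n) ℤ.* + n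
      ≡⟨ cong (λ i → (i ℤ.* + 1 ℤ.+ (ℤ.- q) ℤ.* + n) ℤ.* + n) (ℤD.a≡a%ℕn+[a/ℕn]*n i n) ⟩
    ((+ r ℤ.+ q ℤ.* + n) ℤ.* + 1 ℤ.+ (ℤ.- q) ℤ.* + n) ℤ.* + n
      ≡⟨ cancel (+ r) q (+ n) ⟩
    + r ℤ.* (+ n ℤ.* + 1)
      ≡⟨ cong (+ r ℤ.*_) (sym (ℤP.pos-* n 1)) ⟩
    + r ℤ.* + (n * 1) ∎

ceiling-sub-/ : ∀ i n .{{_ : NonZero n}} →
                ιℤ (ℚ.ceiling (i / n)) ℚ.- i / n ≡ + ((ℤ.- i) ℤ.%ℕ n) / n
ceiling-sub-/ i n = begin
  ιℤ (ℚ.ceiling (i / n)) ℚ.- i / n       ≡⟨ cong (λ z → ιℤ z ℚ.- i / n) (ceiling≡-floor-neg (i / n)) ⟩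
  ιℤ (ℤ.- ℚ.floor (ℚ.- (i / n))) ℚ.- i / n ≡⟨ cong (λ p → ιℤ (ℤ.- ℚ.floor p) ℚ.- i / n) (neg-/ i n) ⟩
  ιℤ (ℤ.- f) ℚ.- i / n                   ≡⟨ cong (ℚ._- i / n) (sym (neg-/ f 1)) ⟩
  ℚ.- ιℤ f ℚ.- i / n                     ≡⟨ ℚP.+-comm (ℚ.- ιℤ f) (ℚ.- (i / n)) ⟩
  ℚ.- (i / n) ℚ.- ιℤ f                   ≡⟨ cong (ℚ._- ιℤ f) (neg-/ i n) ⟩
  (ℤ.- i) / n ℚ.- ιℤ f                   ≡⟨ /-sub-floor (ℤ.- i) n ⟩
  + ((ℤ.- i) ℤ.%ℕ n) / n                 ∎
  where
  open ≡-Reasoning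
  f = ℚ.floor ((ℤ.- i) / n)
  ceiling≡-floor-neg : ∀ p → ℚ.ceiling p ≡ ℤ.- ℚ.floor (ℚ.- p)
  ceiling≡-floor-neg (mkℚ _ _ _) = refl

-- For a > 0, (- a) %ℕ d is the distance from a up to the next multiple of d.
%-⊓-%ℕ-neg : ∀ a d .{{_ : NonZero d}} → (a % d) ⊓ ((ℤ.- + a) ℤ.%ℕ d) ≡ distToMultiple a d
%-⊓-%ℕ-neg 0       (suc d) = refl
%-⊓-%ℕ-neg (suc a) d with suc a % d
... | 0     = refl
... | suc r = refl

Zigzag-/ : ∀ a d .{{_ : NonZero d}} → Zigzag (+ a / d) ≡ + distToMultiple a d / d
Zigzag-/ a d = begin
  Zigzag (+ a / d)                  ≡⟨ cong₂ ℚ._⊓_ (/-sub-floor (+ a) d) (ceiling-sub-/ (+ a) d) ⟩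
  (+ (a % d) / d) ℚ.⊓ (+ r⁻ / d)    ≡⟨ /-⊓-/ (a % d) r⁻ d ⟩
  + ((a % d) ⊓ r⁻) / d              ≡⟨ cong (λ c → + c / d) (%-⊓-%ℕ-neg a d) ⟩
  + distToMultiple a d / d          ∎
  where
  open ≡-Reasoning
  r⁻ = (ℤ.- + a) ℤ.%ℕ d

/-cross-ℕ : ∀ a b m n .{{_ : NonZero m}} .{{_ : NonZero n}} → a * n ≡ b * m → + a / m ≡ + b / n
/-cross-ℕ a b m n eq = /-cross (+ a) (+ b) m n
  (trans (sym (ℤP.pos-* a n)) (trans (cong +_ eq) (ℤP.pos-* b m)))

/-+-/-same : ∀ a b n .{{_ : NonZero n}} → + a / n ℚ.+ + b / n ≡ + (a + b) / n
/-+-/-same a b n = trans (/-+-/ (+ a) (+ b) n n) (/-cross j (+ (a + b)) (n * n) n {{ℕP.m*n≢0 n n}} (begin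
  j ℤ.* + n                         ≡⟨ distrib (+ a) (+ b) (+ n) ⟩
  (+ a ℤ.+ + b) ℤ.* (+ n ℤ.* + n)   ≡⟨ sym (cong₂ ℤ._*_ (ℤP.pos-+ a b) (ℤP.pos-* n n)) ⟩
  + (a + b) ℤ.* + (n * n)           ∎))
  where
  open ≡-Reasoning
  j = + a ℤ.* + n ℤ.+ + b ℤ.* + n
  distrib : ∀ a b n → (a ℤ.* n ℤ.+ b ℤ.* n) ℤ.* n ≡ (a ℤ.+ b) ℤ.* (n ℤ.* n)
  distrib = ℤSolver.solve-∀

pow2≡2^/1 : ∀ i → pow2 i ≡ + (2 ^ i) / 1
pow2≡2^/1 zero    = refl
pow2≡2^/1 (suc i) = trans (cong ((+ 2) / 1 ℚ.*_) (pow2≡2^/1 i))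
  (trans (/-*-/ (+ 2) (+ (2 ^ i)) 1 1) (ℚP./-cong (sym (ℤP.pos-* 2 (2 ^ i))) refl))

pow2-*-/2^ : ∀ i k m → pow2 i ℚ.* ((+ m) /2^ k) ≡ (+ (2 ^ i * m)) /2^ k
pow2-*-/2^ i k m = trans (cong (ℚ._* ((+ m) /2^ k)) (pow2≡2^/1 i))
  (trans (/-*-/ (+ (2 ^ i)) (+ m) 1 (2 ^ k) {{_}} {{2^≢0 k}})
         (ℚP./-cong {{ℕP.m*n≢0 1 (2 ^ k) {{_}} {{2^≢0 k}}}} {{2^≢0 k}}
                    (sym (ℤP.pos-* (2 ^ i) m)) (ℕP.*-identityˡ (2 ^ k))))

/2^-cancel : ∀ i j m → (+ (2 ^ i * m)) /2^ (i + j) ≡ (+ m) /2^ j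
/2^-cancel i j m = /-cross-ℕ (2 ^ i * m) m (2 ^ (i + j)) (2 ^ j) {{2^≢0 (i + j)}} {{2^≢0 j}} (begin
  2 ^ i * m * 2 ^ j       ≡⟨ rearrange (2 ^ i) m (2 ^ j) ⟩
  m * (2 ^ i * 2 ^ j)     ≡⟨ cong (m *_) (sym (ℕP.^-distribˡ-+-* 2 i j)) ⟩
  m * 2 ^ (i + j)         ∎)
  where
  open ≡-Reasoning
  rearrange : ∀ a b c → a * b * c ≡ b * (a * c)
  rearrange = solve-∀

invpow2-*-/2^ : ∀ i j a → invpow2 i ℚ.* ((+ a) /2^ j) ≡ (+ a) /2^ (i + j)
invpow2-*-/2^ i j a = trans (/-*-/ (+ 1) (+ a) (2 ^ i) (2 ^ j) {{2^≢0 i}} {{2^≢0 j}})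
  (ℚP./-cong {{ℕP.m*n≢0 (2 ^ i) (2 ^ j) {{2^≢0 i}} {{2^≢0 j}}}} {{2^≢0 (i + j)}}
             (ℤP.*-identityˡ (+ a)) (sym (ℕP.^-distribˡ-+-* 2 i j)))

term-below : ∀ m i j {k} → i + j ≡ k → term ((+ m) /2^ k) i ≡ (+ distTo2^ m j) /2^ k
term-below m i j refl = begin
  invpow2 i ℚ.* Zigzag (pow2 i ℚ.* ((+ m) /2^ (i + j)))  ≡⟨ cong (λ x → invpow2 i ℚ.* Zigzag x) scaled ⟩
  invpow2 i ℚ.* Zigzag ((+ m) /2^ j)                    ≡⟨ cong (invpow2 i ℚ.*_) (Zigzag-/ m (2 ^ j) {{2^≢0 j}}) ⟩
  invpow2 i ℚ.* ((+ distTo2^ m j) /2^ j)                ≡⟨ invpow2-*-/2^ i j (distTo2^ m j) ⟩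
  (+ distTo2^ m j) /2^ (i + j)                          ∎
  where
  open ≡-Reasoning
  scaled : pow2 i ℚ.* ((+ m) /2^ (i + j)) ≡ (+ m) /2^ j
  scaled = trans (pow2-*-/2^ i (i + j) m) (/2^-cancel i j m)

term-beyond : ∀ m k t → term ((+ m) /2^ k) (k + t) ≡ ℚ.0ℚ
term-beyond m k t = begin
  ε ℚ.* Zigzag (pow2 (k + t) ℚ.* ((+ m) /2^ k))   ≡⟨ cong (λ x → ε ℚ.* Zigzag x) integral ⟩
  ε ℚ.* Zigzag ((+ M) / 1)                        ≡⟨ cong (ε ℚ.*_) (Zigzag-/ M 1) ⟩
  ε ℚ.* ((+ distToMultiple M 1) / 1)              ≡⟨ cong (λ a → ε ℚ.* ((+ a) / 1)) (distToMultiple-1 M) ⟩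
  ε ℚ.* ℚ.0ℚ                                      ≡⟨ ℚP.*-zeroʳ ε ⟩
  ℚ.0ℚ                                            ∎
  where
  open ≡-Reasoning
  ε = invpow2 (k + t)
  M = 2 ^ t * m
  rearrange : ∀ a b c → a * b * c * 1 ≡ b * c * a
  rearrange = solve-∀
  integral : pow2 (k + t) ℚ.* ((+ m) /2^ k) ≡ (+ M) / 1
  integral = trans (pow2-*-/2^ (k + t) k m) (/-cross-ℕ (2 ^ (k + t) * m) M (2 ^ k) 1 {{2^≢0 k}} (begin
    2 ^ (k + t) * m * 1     ≡⟨ cong (λ x → x * m * 1) (ℕP.^-distribˡ-+-* 2 k t) ⟩
    2 ^ k * 2 ^ t * m * 1   ≡⟨ rearrange (2 ^ k) (2 ^ t) m ⟩
    M * 2 ^ k               ∎))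

partial-/2^ : ∀ n i j {k} → i + j ≡ k →
              partial ((+ n) /2^ k) i ℚ.+ (+ dyadicDistSum n j) /2^ k ≡ (+ dyadicDistSum n k) /2^ k
partial-/2^ n zero    j refl = ℚP.+-identityˡ _
partial-/2^ n (suc i) j {k} i+1+j≡k = begin
  partial x i ℚ.+ term x i ℚ.+ S j                  ≡⟨ ℚP.+-assoc (partial x i) (term x i) (S j) ⟩
  partial x i ℚ.+ (term x i ℚ.+ S j)                ≡⟨ cong (λ y → partial x i ℚ.+ (y ℚ.+ S j)) term≡ ⟩
  partial x i ℚ.+ ((+ distTo2^ n (suc j)) /2^ k ℚ.+ S j)
    ≡⟨ cong (partial x i ℚ.+_) (/-+-/-same (distTo2^ n (suc j)) (dyadicDistSum n j) (2 ^ k) {{2^≢0 k}}) ⟩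
  partial x i ℚ.+ S (suc j)                         ≡⟨ partial-/2^ n i (suc j) i+[1+j]≡k ⟩
  S k                                               ∎
  where
  open ≡-Reasoning
  x = (+ n) /2^ k
  S : ℕ → ℚ
  S j = (+ dyadicDistSum n j) /2^ k
  i+[1+j]≡k : i + suc j ≡ k
  i+[1+j]≡k = trans (ℕP.+-suc i j) i+1+j≡k
  term≡ : term x i ≡ (+ distTo2^ n (suc j)) /2^ k
  term≡ = term-below n i (suc j) i+[1+j]≡k

partial-/2^-beyond : ∀ n k m → k ≤ m → partial ((+ n) /2^ k) m ≡ (+ dyadicDistSum n k) /2^ k
partial-/2^-beyond n k m k≤m = begin
  partial x m                     ≡⟨ cong (partial x) (sym (ℕP.m+[n∸m]≡n k≤m)) ⟩
  partial x (k + (m ∸ k))         ≡⟨ stable (m ∸ k) ⟩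
  partial x k                     ≡⟨ sym (ℚP.+-identityʳ (partial x k)) ⟩
  partial x k ℚ.+ ℚ.0ℚ            ≡⟨ cong (partial x k ℚ.+_) (sym (ℚP.0/n≡0 (2 ^ k) {{2^≢0 k}})) ⟩
  partial x k ℚ.+ (+ 0) /2^ k     ≡⟨ partial-/2^ n k 0 (ℕP.+-identityʳ k) ⟩
  (+ dyadicDistSum n k) /2^ k     ∎
  where
  open ≡-Reasoning
  x = (+ n) /2^ k
  stable : ∀ t → partial x (k + t) ≡ partial x k
  stable zero    = cong (partial x) (ℕP.+-identityʳ k)
  stable (suc t) = begin
    partial x (k + suc t)                  ≡⟨ cong (partial x) (ℕP.+-suc k t) ⟩
    partial x (k + t) ℚ.+ term x (k + t)   ≡⟨ cong₂ ℚ._+_ (stable t) (term-beyond n k t) ⟩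
    partial x k ℚ.+ ℚ.0ℚ                   ≡⟨ ℚP.+-identityʳ (partial x k) ⟩
    partial x k                            ∎

eventually-constant⇒ConvergesTo : ∀ {s v} M → (∀ m → M ≤ m → s m ≡ v) → ConvergesTo s v
eventually-constant⇒ConvergesTo {s} {v} M s≡v ε ε>0 = M , λ m M≤m →
  subst (λ y → ℚ.∣ y ℚ.- v ∣ ℚ.< ε) (sym (s≡v m M≤m))
    (subst (ℚ._< ε) (sym (cong ℚ.∣_∣ (ℚP.+-inverseʳ v))) ε>0)

F̃-/2^ : ∀ n k → F̃≡ ((+ n) /2^ k) ((+ dyadicDistSum n k) /2^ k)
F̃-/2^ n k = eventually-constant⇒ConvergesTo k (partial-/2^-beyond n k)

/2^-sub-2 : ∀ {N} b s k → s + b + 2 ^ suc k ≡ N → ((+ N ℤ.- + b) /2^ k) ℚ.- (+ 2) / 1 ≡ (+ s) /2^ k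
/2^-sub-2 {N} b s k s+b+2P≡N = trans (/-sub-/ (+ N ℤ.- + b) (+ 2) P 1 {{2^≢0 k}})
  (/-cross j (+ s) (P * 1) P {{ℕP.m*n≢0 P 1 {{2^≢0 k}}}} {{2^≢0 k}} (begin
    ((+ N ℤ.- + b) ℤ.* + 1 ℤ.+ (ℤ.- + 2) ℤ.* + P) ℤ.* + P
      ≡⟨ cong (λ z → ((z ℤ.- + b) ℤ.* + 1 ℤ.+ (ℤ.- + 2) ℤ.* + P) ℤ.* + P) +N≡ ⟩
    ((+ s ℤ.+ + b ℤ.+ + 2 ℤ.* + P ℤ.- + b) ℤ.* + 1 ℤ.+ (ℤ.- + 2) ℤ.* + P) ℤ.* + P
      ≡⟨ cancel (+ s) (+ b) (+ P) ⟩
    + s ℤ.* (+ P ℤ.* + 1)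
      ≡⟨ cong (+ s ℤ.*_) (sym (ℤP.pos-* P 1)) ⟩
    + s ℤ.* + (P * 1) ∎))
  where
  open ≡-Reasoning
  P = 2 ^ k
  j = (+ N ℤ.- + b) ℤ.* + 1 ℤ.+ (ℤ.- + 2) ℤ.* + P
  +N≡ : + N ≡ + s ℤ.+ + b ℤ.+ + 2 ℤ.* + P
  +N≡ = trans (cong +_ (sym s+b+2P≡N))
          (trans (ℤP.pos-+ (s + b) (2 * P)) (cong₂ ℤ._+_ (ℤP.pos-+ s b) (ℤP.pos-* 2 P)))
  cancel : ∀ s b p → ((s ℤ.+ b ℤ.+ + 2 ℤ.* p ℤ.- b) ℤ.* + 1 ℤ.+ (ℤ.- + 2) ℤ.* p) ℤ.* p ≡ s ℤ.* (p ℤ.* + 1)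
  cancel = ℤSolver.solve-∀

lemma8p2 : (n : ℕ) .{{_ : NonZero n}} →
    F̃≡ ((+ n) /2^ ⌊log₂ n ⌋)
    ((((+ (n ℕ.* (⌊log₂ n ⌋ ℕ.+ 2))) ℤ.- (+ (2 ℕ.* B n))) /2^ ⌊log₂ n ⌋) ℚ.- ((+ 2) ℚ./ 1))
lemma8p2 n = subst (F̃≡ ((+ n) /2^ k)) (sym value) (F̃-/2^ n k)
  where
  k = ⌊log₂ n ⌋
  bounds : 2 ^ k ≤ n × n < 2 ^ suc k
  bounds = ⌊log₂⌋-bounds k n refl
  value : ((+ (n * (k + 2)) ℤ.- + (2 * B n)) /2^ k) ℚ.- (+ 2) / 1 ≡ (+ dyadicDistSum n k) /2^ k
  value = /2^-sub-2 (2 * B n) (dyadicDistSum n k) k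
            (dyadicDistSum+2*B k n (proj₁ bounds) (ℕP.<⇒≤ (proj₂ bounds)))
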